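{- Let $n$ be a positive integer with $\phi(n)=\frac23(n+1)$ ($\phi$ Euler's totient), written as $n=\prod_{i=1}^k q_i$ with $k\geq 3$ and primes $5\leq q_1<\dots<q_k$. Let $L\geq n$ be a real number. (i) For every $j$ with $0\le j\le k-1$, $$q_{j+1}\leq \sqrt[k-j]{\frac{L}{q_1\cdot\ldots\cdot q_j}}.$$ (ii) With $b=\prod_{i=1}^{k-2} q_i$ and $a=\frac{3}{2}\cdot\prod_{i=1}^{k-2}(q_i-1)$, one has $$ab+a-b<(a-b)^2\cdot\frac{L}{b}.$$
   Formalization: The number L ranges over the rationals with L ≥ n rather than over the real numbers. -}

module Defs where

open import Data.Nat as ℕ using (ℕ; zero; suc; _∸_; _≤ᵇ_)
open import Data.Nat.GCD using (gcd)
open import Data.Bool using (if_then_else_)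
open import Data.Integer using (+_)
open import Data.Rational as ℚ using (ℚ; _/_; 0ℚ)

countCoprime : ℕ → ℕ → ℕ
countCoprime n zero = 0
countCoprime n (suc m) =
  (if gcd (suc m) n ℕ.≡ᵇ 1 then 1 else 0) ℕ.+ countCoprime n m

φ : ℕ → ℕ
φ n = countCoprime n n

-- 1-based finite product:  ∏_{i=1}^{m} f i
∏ : (ℕ → ℕ) → ℕ → ℕ
∏ f zero = 1
∏ f (suc m) = ∏ f m ℕ.* f (suc m)

⟦_⟧ : ℕ → ℚ
⟦ n ⟧ = + n / 1

-- division of a rational by a natural number (only used with positive divisors;
-- the value at divisor 0 is an irrelevant convention)
_÷ℕ_ : ℚ → ℕ → ℚ
x ÷ℕ zero = 0ℚ
x ÷ℕ suc d = x ℚ.* (+ 1 / suc d)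

{-# OPTIONS --safe #-}
module Submission where

-- Since q₁ < ⋯ < q_k are distinct primes, φ(m p) = (p − 1) φ(m) for each new prime factor p: of
-- the numbers 1, …, m p exactly p φ(m) are coprime to m (by periodicity), and φ(m) of those are
-- multiples of p.  Part (i) is monotonicity: q₁⋯q_j · q_{j+1}^{k−j} ≤ q₁⋯q_k = n ≤ L.
-- For part (ii) let p = q_{k−1} and r = q_k, so that n = b p r, φ(n) = (2a/3)(p − 1)(r − 1), and
-- the hypothesis reads a(p − 1)(r − 1) = b p r + 1.  Subtracting b(p − 1)(r − 1) gives
-- (a − b)(p − 1)(r − 1) = b(p + r − 1) + 1, hence a > b and (a − b)(p + r − 2) > b.  Expanding
-- (a − b)² p r by the same identity, the claim becomes b² < b(a − b)(p + r − 2) + (a − b)²(p + r − 1),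
-- and it remains to use L / b ≥ n / b = p r.

open import Defs
open import Algebra.Properties.CommutativeSemigroup as CommutativeSemigroupProperties using ()
open import Data.Bool.Base using (Bool; true; false; _∧_; not; if_then_else_)
open import Data.Bool.Properties using (∧-identityʳ; ∧-zeroʳ)
open import Data.Integer.Base as ℤ using (+_)
import Data.Integer.Properties as ℤ
open import Data.Nat as ℕ
  using (ℕ; zero; suc; _+_; _*_; _∸_; _^_; _≤_; _<_; s≤s; z<s; NonZero; nonTrivial⇒≢1; >-nonZero⁻¹)
open import Data.Nat.Properties
open import Data.Nat.Coprimality as Coprime
  using (Coprime; coprime?; coprime-+; coprime-divisor; prime⇒coprime; 1-coprimeTo)
open import Data.Nat.Divisibility using (_∣_; _∣?_; ∣-refl; ∣-trans; >⇒∤; ∣m+n∣m⇒∣n; ∣m∣n⇒∣m+n; m∣m*n; n∣m*n)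
open import Data.Nat.Primality using (Prime; prime⇒irreducible; prime⇒nonTrivial; prime⇒nonZero)
open import Data.Nat.Tactic.RingSolver using (solve-∀)
open import Data.Product using (_×_; _,_; proj₁; proj₂)
open import Data.Rational as ℚ using (ℚ; _/_; mkℚ; toℚᵘ; 1ℚ; ½)
import Data.Rational.Properties as ℚ
open import Data.Rational.Solver using (module +-*-Solver)
open import Data.Rational.Unnormalised.Base as ℚᵘ using (mkℚᵘ; *≡*)
import Data.Rational.Unnormalised.Properties as ℚᵘ
open import Data.Sum.Base using (inj₁; inj₂)
open import Function.Bundles using (_⇔_; mk⇔)
open import Relation.Nullary.Negation using (¬_; contradiction)
open import Relation.Nullary.Decidable using (does; ¬?; _×-dec_; does-⇔; dec-true; dec-false)
open import Relation.Binary.PropositionalEquality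
  using (_≡_; _≗_; refl; sym; trans; cong; cong₂; subst; subst₂; module ≡-Reasoning)

open +-*-Solver using (solve; _:+_; _:*_; _:-_; con; _:=_)
open CommutativeSemigroupProperties +-commutativeSemigroup using (x∙yz≈y∙xz)
open CommutativeSemigroupProperties *-commutativeSemigroup using (x∙yz≈xz∙y)

[_] : Bool → ℕ
[ b ] = if b then 1 else 0

count : (ℕ → Bool) → ℕ → ℕ
count f zero    = 0
count f (suc m) = [ f (suc m) ] + count f m

count-cong : ∀ {f g} → f ≗ g → ∀ m → count f m ≡ count g m
count-cong f≗g zero    = refl
count-cong f≗g (suc m) = cong₂ (λ b c → [ b ] + c) (f≗g (suc m)) (count-cong f≗g m)

count-none : ∀ (f : ℕ → Bool) m → (∀ x → x < m → f (suc x) ≡ false) → count f m ≡ 0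
count-none f zero    _       = refl
count-none f (suc m) f≡false rewrite f≡false m ≤-refl =
  count-none f m (λ x x<m → f≡false x (m<n⇒m<1+n x<m))

count-+ : ∀ (f : ℕ → Bool) a m → count f (a + m) ≡ count f a + count (λ x → f (a + x)) m
count-+ f a zero    rewrite +-identityʳ a = sym (+-identityʳ _)
count-+ f a (suc m) rewrite +-suc a m | count-+ f a m = x∙yz≈y∙xz [ f (suc (a + m)) ] (count f a) _

count-split : ∀ (f g : ℕ → Bool) m →
  count f m ≡ count (λ x → f x ∧ g x) m + count (λ x → f x ∧ not (g x)) m
count-split f g zero = refl
count-split f g (suc m) with f (suc m) | g (suc m)
... | true  | true  = cong suc (count-split f g m)
... | true  | false = trans (cong suc (count-split f g m)) (sym (+-suc _ _))
... | false | _     = count-split f g m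

count-periodic : ∀ (f : ℕ → Bool) m → (∀ x → f (m + x) ≡ f x) → ∀ p → count f (p * m) ≡ p * count f m
count-periodic f m periodic zero    = refl
count-periodic f m periodic (suc p) = begin
  count f (m + p * m)                          ≡⟨ count-+ f m (p * m) ⟩
  count f m + count (λ x → f (m + x)) (p * m)  ≡⟨ cong (_+_ (count f m)) (count-cong periodic (p * m)) ⟩
  count f m + count f (p * m)                  ≡⟨ cong (_+_ (count f m)) (count-periodic f m periodic p) ⟩
  count f m + p * count f m                    ∎
  where open ≡-Reasoning

divisibleBy : ℕ → ℕ → Bool
divisibleBy p x = does (p ∣? x)

count-multiples : ∀ p .{{_ : NonZero p}} (f : ℕ → Bool) m →
  count (λ x → f x ∧ divisibleBy p x) (m * p) ≡ count (λ y → f (y * p)) m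
count-multiples p          f zero    = refl
count-multiples p@(suc p′) f (suc m) = begin
  count h (p + m * p)
    ≡⟨ count-+ h p (m * p) ⟩
  count h p + count (λ x → h (p + x)) (m * p)
    ≡⟨ cong₂ _+_ first-block (count-cong shift (m * p)) ⟩
  [ f p ] + count (λ x → f (p + x) ∧ divisibleBy p x) (m * p)
    ≡⟨ cong (_+_ [ f p ]) (count-multiples p (λ x → f (p + x)) m) ⟩
  [ f p ] + count (λ y → g (1 + y)) m
    ≡⟨ cong (_+ count (λ y → g (1 + y)) m) first-multiple ⟩
  count g 1 + count (λ y → g (1 + y)) m
    ≡⟨ count-+ g 1 m ⟨
  count g (1 + m)
    ∎
  where
  open ≡-Reasoning
  h : ℕ → Bool
  h x = f x ∧ divisibleBy p x
  g : ℕ → Bool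
  g y = f (y * p)
  h[p]≡f[p] : h p ≡ f p
  h[p]≡f[p] = trans (cong (f p ∧_) (dec-true (p ∣? p) ∣-refl)) (∧-identityʳ (f p))
  h-below-p : ∀ x → x < p′ → h (suc x) ≡ false
  h-below-p x x<p′ = trans (cong (f (suc x) ∧_) (dec-false (p ∣? suc x) (>⇒∤ (s≤s x<p′)))) (∧-zeroʳ _)
  first-block : count h p ≡ [ f p ]
  first-block = begin
    [ h p ] + count h p′  ≡⟨ cong₂ _+_ (cong [_] h[p]≡f[p]) (count-none h p′ h-below-p) ⟩
    [ f p ] + 0           ≡⟨ +-identityʳ _ ⟩
    [ f p ]               ∎
  first-multiple : [ f p ] ≡ count g 1
  first-multiple = trans (cong (λ x → [ f x ]) (sym (+-identityʳ p))) (sym (+-identityʳ _))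
  shift : ∀ x → h (p + x) ≡ f (p + x) ∧ divisibleBy p x
  shift x = cong (f (p + x) ∧_)
    (does-⇔ (mk⇔ (λ p∣p+x → ∣m+n∣m⇒∣n p∣p+x ∣-refl) (∣m∣n⇒∣m+n ∣-refl)) (p ∣? (p + x)) (p ∣? x))

coprime-∣ˡ : ∀ {d m n} → d ∣ m → Coprime m n → Coprime d n
coprime-∣ˡ d∣m coprime (i∣d , i∣n) = coprime (∣-trans i∣d d∣m , i∣n)

coprime-*ʳ : ∀ {m n o} → Coprime m n → Coprime m o → Coprime m (n * o)
coprime-*ʳ coprime-mn coprime-mo (i∣m , i∣no) =
  coprime-mo (i∣m , coprime-divisor (coprime-∣ˡ i∣m coprime-mn) i∣no)

∤⇒coprime : ∀ {p x} → Prime p → ¬ p ∣ x → Coprime x p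
∤⇒coprime p-prime p∤x (i∣x , i∣p) with prime⇒irreducible p-prime i∣p
... | inj₁ i≡1  = i≡1
... | inj₂ refl = contradiction i∣x p∤x

coprime-*-prime⇔ : ∀ {m p x} → Prime p → Coprime x (m * p) ⇔ (Coprime x m × ¬ p ∣ x)
coprime-*-prime⇔ {m} {p} {x} p-prime = mk⇔ to from
  where
  to : Coprime x (m * p) → Coprime x m × ¬ p ∣ x
  to coprime = (λ (i∣x , i∣m) → coprime (i∣x , ∣-trans i∣m (m∣m*n p)))
             , (λ p∣x → nonTrivial⇒≢1 {{prime⇒nonTrivial p-prime}} (coprime (p∣x , n∣m*n m)))
  from : Coprime x m × ¬ p ∣ x → Coprime x (m * p)
  from (coprime-xm , p∤x) = coprime-*ʳ coprime-xm (∤⇒coprime p-prime p∤x)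

coprime-*ˡ⇔ : ∀ {m p y} → Coprime p m → Coprime (y * p) m ⇔ Coprime y m
coprime-*ˡ⇔ {p = p} coprime-pm = mk⇔
  (coprime-∣ˡ (m∣m*n p))
  (λ coprime-ym → Coprime.sym (coprime-*ʳ (Coprime.sym coprime-ym) (Coprime.sym coprime-pm)))

coprime-+ˡ⇔ : ∀ {m x} → Coprime (m + x) m ⇔ Coprime x m
coprime-+ˡ⇔ {m} {x} = mk⇔ to coprime-+
  where
  to : Coprime (m + x) m → Coprime x m
  to coprime (i∣x , i∣m) = coprime (∣m∣n⇒∣m+n i∣m i∣x , i∣m)

coprimeTo : ℕ → ℕ → Bool
coprimeTo m x = does (coprime? x m)

φ≡count : ∀ n → φ n ≡ count (coprimeTo n) n
φ≡count n = go n
  where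
  go : ∀ m → countCoprime n m ≡ count (coprimeTo n) m
  go zero    = refl
  go (suc m) = cong (_+_ [ coprimeTo n (suc m) ]) (go m)

φ-*-prime : ∀ {m p} → Prime p → Coprime p m → φ (m * p) ≡ (p ∸ 1) * φ m
φ-*-prime {m} {p} p-prime coprime-pm = begin
  φ (m * p)              ≡⟨ m+n∸m≡n (φ m) (φ (m * p)) ⟨
  φ m + φ (m * p) ∸ φ m  ≡⟨ cong (_∸ φ m) counting ⟩
  p * φ m ∸ φ m          ≡⟨ cong (p * φ m ∸_) (*-identityˡ (φ m)) ⟨
  p * φ m ∸ 1 * φ m      ≡⟨ *-distribʳ-∸ (φ m) p 1 ⟨
  (p ∸ 1) * φ m          ∎
  where
  open ≡-Reasoning
  instance
    p≢0 : NonZero p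
    p≢0 = prime⇒nonZero p-prime
  coprimeTo-*-prime : ∀ x → coprimeTo (m * p) x ≡ coprimeTo m x ∧ not (divisibleBy p x)
  coprimeTo-*-prime x = does-⇔ (coprime-*-prime⇔ p-prime) (coprime? x (m * p)) (coprime? x m ×-dec ¬? (p ∣? x))
  coprimeTo-*ˡ : ∀ y → coprimeTo m (y * p) ≡ coprimeTo m y
  coprimeTo-*ˡ y = does-⇔ (coprime-*ˡ⇔ coprime-pm) (coprime? (y * p) m) (coprime? y m)
  coprimeTo-+ˡ : ∀ x → coprimeTo m (m + x) ≡ coprimeTo m x
  coprimeTo-+ˡ x = does-⇔ coprime-+ˡ⇔ (coprime? (m + x) m) (coprime? x m)
  multiples : count (λ x → coprimeTo m x ∧ divisibleBy p x) (m * p) ≡ φ m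
  multiples = begin
    count (λ x → coprimeTo m x ∧ divisibleBy p x) (m * p)  ≡⟨ count-multiples p (coprimeTo m) m ⟩
    count (λ y → coprimeTo m (y * p)) m                    ≡⟨ count-cong coprimeTo-*ˡ m ⟩
    count (coprimeTo m) m                                  ≡⟨ φ≡count m ⟨
    φ m                                                    ∎
  non-multiples : count (λ x → coprimeTo m x ∧ not (divisibleBy p x)) (m * p) ≡ φ (m * p)
  non-multiples = begin
    count (λ x → coprimeTo m x ∧ not (divisibleBy p x)) (m * p)  ≡⟨ count-cong coprimeTo-*-prime (m * p) ⟨
    count (coprimeTo (m * p)) (m * p)                            ≡⟨ φ≡count (m * p) ⟨
    φ (m * p)                                                    ∎
  counting : φ m + φ (m * p) ≡ p * φ m
  counting = begin
    φ m + φ (m * p)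
      ≡⟨ cong₂ _+_ multiples non-multiples ⟨
    count (λ x → coprimeTo m x ∧ divisibleBy p x) (m * p)
      + count (λ x → coprimeTo m x ∧ not (divisibleBy p x)) (m * p)
      ≡⟨ count-split (coprimeTo m) (divisibleBy p) (m * p) ⟨
    count (coprimeTo m) (m * p)
      ≡⟨ cong (count (coprimeTo m)) (*-comm m p) ⟩
    count (coprimeTo m) (p * m)
      ≡⟨ count-periodic (coprimeTo m) m coprimeTo-+ˡ p ⟩
    p * count (coprimeTo m) m
      ≡⟨ cong (p *_) (φ≡count m) ⟨
    p * φ m
      ∎

⟦⟧≡mkℚ : ∀ n → ⟦ n ⟧ ≡ mkℚ (+ n) 0 (Coprime.sym (1-coprimeTo n))
⟦⟧≡mkℚ n = ℚ.normalize-coprime (Coprime.sym (1-coprimeTo n))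

toℚᵘ-⟦⟧ : ∀ n → toℚᵘ ⟦ n ⟧ ≡ mkℚᵘ (+ n) 0
toℚᵘ-⟦⟧ n = cong toℚᵘ (⟦⟧≡mkℚ n)

⟦⟧-homo-+ : ∀ m n → ⟦ m + n ⟧ ≡ ⟦ m ⟧ ℚ.+ ⟦ n ⟧
⟦⟧-homo-+ m n = ℚ.toℚᵘ-injective (begin
  toℚᵘ ⟦ m + n ⟧                  ≡⟨ toℚᵘ-⟦⟧ (m + n) ⟩
  mkℚᵘ (+ (m + n)) 0              ≈⟨ *≡* (cong (ℤ._* + 1) +[m+n]≡+m*1++n*1) ⟩
  mkℚᵘ (+ m) 0 ℚᵘ.+ mkℚᵘ (+ n) 0  ≡⟨ cong₂ ℚᵘ._+_ (toℚᵘ-⟦⟧ m) (toℚᵘ-⟦⟧ n) ⟨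
  toℚᵘ ⟦ m ⟧ ℚᵘ.+ toℚᵘ ⟦ n ⟧      ≈⟨ ℚ.toℚᵘ-homo-+ ⟦ m ⟧ ⟦ n ⟧ ⟨
  toℚᵘ (⟦ m ⟧ ℚ.+ ⟦ n ⟧)          ∎)
  where
  open ℚᵘ.≃-Reasoning
  +[m+n]≡+m*1++n*1 : + (m + n) ≡ + m ℤ.* + 1 ℤ.+ + n ℤ.* + 1
  +[m+n]≡+m*1++n*1 = trans (ℤ.pos-+ m n) (sym (cong₂ ℤ._+_ (ℤ.*-identityʳ (+ m)) (ℤ.*-identityʳ (+ n))))

⟦⟧-homo-* : ∀ m n → ⟦ m * n ⟧ ≡ ⟦ m ⟧ ℚ.* ⟦ n ⟧
⟦⟧-homo-* m n = ℚ.toℚᵘ-injective (begin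
  toℚᵘ ⟦ m * n ⟧                  ≡⟨ toℚᵘ-⟦⟧ (m * n) ⟩
  mkℚᵘ (+ (m * n)) 0              ≈⟨ *≡* (cong (ℤ._* + 1) (ℤ.pos-* m n)) ⟩
  mkℚᵘ (+ m) 0 ℚᵘ.* mkℚᵘ (+ n) 0  ≡⟨ cong₂ ℚᵘ._*_ (toℚᵘ-⟦⟧ m) (toℚᵘ-⟦⟧ n) ⟨
  toℚᵘ ⟦ m ⟧ ℚᵘ.* toℚᵘ ⟦ n ⟧      ≈⟨ ℚ.toℚᵘ-homo-* ⟦ m ⟧ ⟦ n ⟧ ⟨
  toℚᵘ (⟦ m ⟧ ℚ.* ⟦ n ⟧)          ∎)
  where open ℚᵘ.≃-Reasoning

⟦⟧-mono-≤ : ∀ {m n} → m ≤ n → ⟦ m ⟧ ℚ.≤ ⟦ n ⟧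
⟦⟧-mono-≤ {m} {n} m≤n =
  subst₂ ℚ._≤_ (sym (⟦⟧≡mkℚ m)) (sym (⟦⟧≡mkℚ n)) (ℚ.*≤* (ℤ.*-monoʳ-≤-nonNeg (+ 1) (ℤ.+≤+ m≤n)))

⟦⟧-mono-< : ∀ {m n} → m < n → ⟦ m ⟧ ℚ.< ⟦ n ⟧
⟦⟧-mono-< {m} {n} m<n =
  subst₂ ℚ._<_ (sym (⟦⟧≡mkℚ m)) (sym (⟦⟧≡mkℚ n)) (ℚ.*<* (ℤ.*-monoʳ-<-pos (+ 1) (ℤ.+<+ m<n)))

⟦⟧-injective : ∀ {m n} → ⟦ m ⟧ ≡ ⟦ n ⟧ → m ≡ n
⟦⟧-injective {m} {n} eq = ℤ.+-injective (cong ℚ.↥_ (trans (sym (⟦⟧≡mkℚ m)) (trans eq (⟦⟧≡mkℚ n))))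

⟦n⟧*[1/n]≡1 : ∀ n .{{_ : NonZero n}} → ⟦ n ⟧ ℚ.* (+ 1 / n) ≡ 1ℚ
⟦n⟧*[1/n]≡1 n@(suc _) = trans
  (cong₂ ℚ._*_ (⟦⟧≡mkℚ n) (ℚ.normalize-coprime (1-coprimeTo n)))
  (ℚ.*-inverseʳ (mkℚ (+ n) 0 (Coprime.sym (1-coprimeTo n))))

*≤⇒≤÷ℕ : ∀ {m x} L .{{_ : NonZero m}} → ⟦ m * x ⟧ ℚ.≤ L → ⟦ x ⟧ ℚ.≤ L ÷ℕ m
*≤⇒≤÷ℕ {m@(suc _)} {x} L mx≤L = begin
  ⟦ x ⟧                            ≡⟨ ℚ.*-identityʳ ⟦ x ⟧ ⟨
  ⟦ x ⟧ ℚ.* 1ℚ                     ≡⟨ cong (⟦ x ⟧ ℚ.*_) (⟦n⟧*[1/n]≡1 m) ⟨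
  ⟦ x ⟧ ℚ.* (⟦ m ⟧ ℚ.* (+ 1 / m))  ≡⟨ rearrange ⟦ x ⟧ ⟦ m ⟧ (+ 1 / m) ⟩
  ⟦ m ⟧ ℚ.* ⟦ x ⟧ ℚ.* (+ 1 / m)    ≡⟨ cong (ℚ._* (+ 1 / m)) (⟦⟧-homo-* m x) ⟨
  ⟦ m * x ⟧ ℚ.* (+ 1 / m)          ≤⟨ ℚ.*-monoʳ-≤-nonNeg (+ 1 / m) {{ℚ.normalize-nonNeg 1 m}} mx≤L ⟩
  L ℚ.* (+ 1 / m)                  ∎
  where
  open ℚ.≤-Reasoning
  rearrange : ∀ a b c → a ℚ.* (b ℚ.* c) ≡ b ℚ.* a ℚ.* c
  rearrange = solve 3 (λ a b c → a :* (b :* c) := b :* a :* c) refl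

3φ≡2[n+1] : ∀ {n} → ⟦ φ n ⟧ ≡ (+ 2 / 3) ℚ.* ⟦ n + 1 ⟧ → 3 * φ n ≡ 2 * (n + 1)
3φ≡2[n+1] {n} φ≡⅔[n+1] = ⟦⟧-injective (begin
  ⟦ 3 * φ n ⟧                          ≡⟨ ⟦⟧-homo-* 3 (φ n) ⟩
  ⟦ 3 ⟧ ℚ.* ⟦ φ n ⟧                    ≡⟨ cong (ℚ._*_ ⟦ 3 ⟧) φ≡⅔[n+1] ⟩
  ⟦ 3 ⟧ ℚ.* ((+ 2 / 3) ℚ.* ⟦ n + 1 ⟧)  ≡⟨ cancel-thirds ⟦ n + 1 ⟧ ⟩
  ⟦ 2 ⟧ ℚ.* ⟦ n + 1 ⟧                  ≡⟨ ⟦⟧-homo-* 2 (n + 1) ⟨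
  ⟦ 2 * (n + 1) ⟧                      ∎)
  where
  open ≡-Reasoning
  cancel-thirds : ∀ x → ⟦ 3 ⟧ ℚ.* ((+ 2 / 3) ℚ.* x) ≡ ⟦ 2 ⟧ ℚ.* x
  cancel-thirds = solve 1 (λ x → con ⟦ 3 ⟧ :* (con (+ 2 / 3) :* x) := con ⟦ 2 ⟧ :* x) refl

module IncreasingPrimes (k : ℕ) (q : ℕ → ℕ)
  (q-prime : ∀ i → 1 ≤ i → i ≤ k → Prime (q i))
  (increasing : ∀ i → 1 ≤ i → i < k → q i < q (suc i))
  where

  q-mono-< : ∀ {i j} → 1 ≤ i → i < j → j ≤ k → q i < q j
  q-mono-< {i} {suc j} 1≤i (s≤s i≤j) j<k with m≤n⇒m<n∨m≡n i≤j
  ... | inj₁ i<j  = <-trans (q-mono-< 1≤i i<j (<⇒≤ j<k)) (increasing j (≤-trans 1≤i (<⇒≤ i<j)) j<k)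
  ... | inj₂ refl = increasing i 1≤i j<k

  q-mono-≤ : ∀ {i j} → 1 ≤ i → i ≤ j → j ≤ k → q i ≤ q j
  q-mono-≤ 1≤i i≤j j≤k with m≤n⇒m<n∨m≡n i≤j
  ... | inj₁ i<j  = <⇒≤ (q-mono-< 1≤i i<j j≤k)
  ... | inj₂ refl = ≤-refl

  q-nonZero : ∀ i → 1 ≤ i → i ≤ k → NonZero (q i)
  q-nonZero i 1≤i i≤k = prime⇒nonZero (q-prime i 1≤i i≤k)

  q-positive : ∀ i → 1 ≤ i → i ≤ k → 0 < q i
  q-positive i 1≤i i≤k = >-nonZero⁻¹ (q i) {{q-nonZero i 1≤i i≤k}}

  ∏-nonZero : ∀ j → j ≤ k → NonZero (∏ q j)
  ∏-nonZero zero    _   = _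
  ∏-nonZero (suc j) j<k = m*n≢0 (∏ q j) (q (suc j)) {{∏-nonZero j (<⇒≤ j<k)}} {{q-nonZero (suc j) z<s j<k}}

  coprime-∏ : ∀ {p} → Prime p → ∀ j → j ≤ k → (∀ i → 1 ≤ i → i ≤ j → q i < p) → Coprime p (∏ q j)
  coprime-∏ p-prime zero    _   _   = Coprime.sym (1-coprimeTo _)
  coprime-∏ p-prime (suc j) j<k q<p = coprime-*ʳ
    (coprime-∏ p-prime j (<⇒≤ j<k) (λ i 1≤i i≤j → q<p i 1≤i (m≤n⇒m≤1+n i≤j)))
    (prime⇒coprime p-prime {{q-nonZero (suc j) z<s j<k}} (q<p (suc j) z<s ≤-refl))

  φ-∏ : ∀ j → j ≤ k → φ (∏ q j) ≡ ∏ (λ i → q i ∸ 1) j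
  φ-∏ zero    _   = refl
  φ-∏ (suc j) j<k = begin
    φ (∏ q j * q (suc j))                  ≡⟨ φ-*-prime (q-prime (suc j) z<s j<k) coprime-q ⟩
    (q (suc j) ∸ 1) * φ (∏ q j)            ≡⟨ cong ((q (suc j) ∸ 1) *_) (φ-∏ j (<⇒≤ j<k)) ⟩
    (q (suc j) ∸ 1) * ∏ (λ i → q i ∸ 1) j  ≡⟨ *-comm (q (suc j) ∸ 1) _ ⟩
    ∏ (λ i → q i ∸ 1) j * (q (suc j) ∸ 1)  ∎
    where
    open ≡-Reasoning
    coprime-q : Coprime (q (suc j)) (∏ q j)
    coprime-q = coprime-∏ (q-prime (suc j) z<s j<k) j (<⇒≤ j<k) (λ i 1≤i i≤j → q-mono-< 1≤i (s≤s i≤j) j<k)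

  ∏*^≤∏ : ∀ j d → j + d ≤ k → ∏ q j * q (suc j) ^ d ≤ ∏ q (j + d)
  ∏*^≤∏ j zero    j≤k   rewrite +-identityʳ j = ≤-reflexive (*-identityʳ (∏ q j))
  ∏*^≤∏ j (suc d) j+d<k rewrite +-suc j d = begin
    ∏ q j * (q (suc j) * q (suc j) ^ d)  ≡⟨ x∙yz≈xz∙y (∏ q j) (q (suc j)) _ ⟩
    ∏ q j * q (suc j) ^ d * q (suc j)    ≤⟨ *-mono-≤ (∏*^≤∏ j d (<⇒≤ j+d<k)) (q-mono-≤ z<s (s≤s (m≤m+n j d)) j+d<k) ⟩
    ∏ q (j + d) * q (suc (j + d))        ∎
    where open ≤-Reasoning

  q[1+j]^[k∸j]≤L/∏ : ∀ {L} j → j ≤ k → ⟦ ∏ q k ⟧ ℚ.≤ L → ⟦ q (suc j) ^ (k ∸ j) ⟧ ℚ.≤ L ÷ℕ ∏ q j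
  q[1+j]^[k∸j]≤L/∏ {L} j j≤k ∏≤L = *≤⇒≤÷ℕ L {{∏-nonZero j j≤k}} (ℚ.≤-trans (⟦⟧-mono-≤ ∏*^≤∏q) ∏≤L)
    where
    j+[k∸j]≡k : j + (k ∸ j) ≡ k
    j+[k∸j]≡k = m+[n∸m]≡n j≤k
    ∏*^≤∏q : ∏ q j * q (suc j) ^ (k ∸ j) ≤ ∏ q k
    ∏*^≤∏q = ≤-trans (∏*^≤∏ j (k ∸ j) (≤-reflexive j+[k∸j]≡k)) (≤-reflexive (cong (∏ q) j+[k∸j]≡k))

-- With α = 2a, β = 2b and δ = α − β, the hypothesis below is a(p − 1)(r − 1) = b p r + 1 and the
-- conclusion of totient-relation⇒inequality is 4(ab + a − b) < 4(a − b)² p r; doubling keeps them in ℕ.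
totient-relation⇒< : ∀ {α β p r} → α * (p ∸ 1) * (r ∸ 1) ≡ β * (p * r) + 2 → β < α
totient-relation⇒< {α} {β} {p} {r} eq = ≰⇒> α≰β
  where
  α≰β : ¬ α ≤ β
  α≰β α≤β = <-irrefl eq (begin-strict
    α * (p ∸ 1) * (r ∸ 1)    ≤⟨ *-monoˡ-≤ (r ∸ 1) (*-monoˡ-≤ (p ∸ 1) α≤β) ⟩
    β * (p ∸ 1) * (r ∸ 1)    ≡⟨ *-assoc β (p ∸ 1) (r ∸ 1) ⟩
    β * ((p ∸ 1) * (r ∸ 1))  ≤⟨ *-monoʳ-≤ β (*-mono-≤ (m∸n≤m p 1) (m∸n≤m r 1)) ⟩
    β * (p * r)              <⟨ m<m+n (β * (p * r)) z<s ⟩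
    β * (p * r) + 2          ∎)
    where open ≤-Reasoning

totient-relation⇒inequality : ∀ {β δ p r} .{{_ : NonZero β}} → 1 ≤ p → 1 ≤ r →
  (β + δ) * (p ∸ 1) * (r ∸ 1) ≡ β * (p * r) + 2 → (β + δ) * β + 2 * δ < δ * δ * (p * r)
totient-relation⇒inequality {β} {δ} {suc x} {suc y} _ _ eq = begin-strict
  (β + δ) * β + 2 * δ                              ≡⟨ regroup β δ ⟩
  β * β + (δ * β + 2 * δ)                          <⟨ +-monoˡ-< (δ * β + 2 * δ) (*-monoʳ-< β β<δ[x+y]) ⟩
  β * (δ * (x + y)) + (δ * β + 2 * δ)              ≤⟨ m≤m+n _ (δ * δ * s) ⟩
  β * (δ * (x + y)) + (δ * β + 2 * δ) + δ * δ * s  ≡⟨ factor β δ x y ⟩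
  δ * (β * s + 2) + δ * δ * s                      ≡⟨ cong (λ t → δ * t + δ * δ * s) δxy≡βs+2 ⟨
  δ * (δ * (x * y)) + δ * δ * s                    ≡⟨ collect δ x y ⟩
  δ * δ * (suc x * suc y)                          ∎
  where
  open ≤-Reasoning
  s : ℕ
  s = x + y + 1
  regroup : ∀ β δ → (β + δ) * β + 2 * δ ≡ β * β + (δ * β + 2 * δ)
  regroup = solve-∀
  factor : ∀ β δ x y → β * (δ * (x + y)) + (δ * β + 2 * δ) + δ * δ * (x + y + 1)
                     ≡ δ * (β * (x + y + 1) + 2) + δ * δ * (x + y + 1)
  factor = solve-∀
  collect : ∀ δ x y → δ * (δ * (x * y)) + δ * δ * (x + y + 1) ≡ δ * δ * (suc x * suc y)
  collect = solve-∀
  δxy≡βs+2 : δ * (x * y) ≡ β * s + 2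
  δxy≡βs+2 = +-cancelˡ-≡ (β * (x * y)) _ _ (begin-equality
    β * (x * y) + δ * (x * y)  ≡⟨ distribute β δ x y ⟩
    (β + δ) * x * y            ≡⟨ eq ⟩
    β * (suc x * suc y) + 2    ≡⟨ expand β x y ⟩
    β * (x * y) + (β * s + 2)  ∎)
    where
    distribute : ∀ β δ x y → β * (x * y) + δ * (x * y) ≡ (β + δ) * x * y
    distribute = solve-∀
    expand : ∀ β x y → β * (suc x * suc y) + 2 ≡ β * (x * y) + (β * (x + y + 1) + 2)
    expand = solve-∀
  β<δ[x+y] : β < δ * (x + y)
  β<δ[x+y] = *-cancelʳ-< s β (δ * (x + y)) (begin-strict
    β * s              <⟨ m<m+n (β * s) z<s ⟩
    β * s + 2          ≡⟨ δxy≡βs+2 ⟨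
    δ * (x * y)        ≤⟨ *-monoʳ-≤ δ (*-mono-≤ (m≤m+n x y) (≤-trans (m≤n+m y x) (m≤m+n (x + y) 1))) ⟩
    δ * ((x + y) * s)  ≡⟨ *-assoc δ (x + y) s ⟨
    δ * (x + y) * s    ∎)

3A/2≡b+δ/2 : ∀ {A b δ} → 3 * A ≡ 2 * b + δ → (+ 3 / 2) ℚ.* ⟦ A ⟧ ≡ ⟦ b ⟧ ℚ.+ ⟦ δ ⟧ ℚ.* ½
3A/2≡b+δ/2 {A} {b} {δ} 3A≡2b+δ = begin
  (+ 3 / 2) ℚ.* ⟦ A ⟧                 ≡⟨ three-halves ⟦ A ⟧ ⟩
  ⟦ 3 ⟧ ℚ.* ⟦ A ⟧ ℚ.* ½               ≡⟨ cong (ℚ._* ½) (⟦⟧-homo-* 3 A) ⟨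
  ⟦ 3 * A ⟧ ℚ.* ½                     ≡⟨ cong (λ n → ⟦ n ⟧ ℚ.* ½) 3A≡2b+δ ⟩
  ⟦ 2 * b + δ ⟧ ℚ.* ½                 ≡⟨ cong (ℚ._* ½) (⟦⟧-homo-+ (2 * b) δ) ⟩
  (⟦ 2 * b ⟧ ℚ.+ ⟦ δ ⟧) ℚ.* ½         ≡⟨ cong (λ t → (t ℚ.+ ⟦ δ ⟧) ℚ.* ½) (⟦⟧-homo-* 2 b) ⟩
  (⟦ 2 ⟧ ℚ.* ⟦ b ⟧ ℚ.+ ⟦ δ ⟧) ℚ.* ½   ≡⟨ halve ⟦ b ⟧ ⟦ δ ⟧ ⟩
  ⟦ b ⟧ ℚ.+ ⟦ δ ⟧ ℚ.* ½               ∎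
  where
  open ≡-Reasoning
  three-halves : ∀ x → (+ 3 / 2) ℚ.* x ≡ ⟦ 3 ⟧ ℚ.* x ℚ.* ½
  three-halves = solve 1 (λ x → con (+ 3 / 2) :* x := con ⟦ 3 ⟧ :* x :* con ½) refl
  halve : ∀ x y → (⟦ 2 ⟧ ℚ.* x ℚ.+ y) ℚ.* ½ ≡ x ℚ.+ y ℚ.* ½
  halve = solve 2 (λ x y → (con ⟦ 2 ⟧ :* x :+ y) :* con ½ := x :+ y :* con ½) refl

⟦[2b+δ]2b+2δ⟧≡4[ab+a-b] : ∀ b δ → let a = ⟦ b ⟧ ℚ.+ ⟦ δ ⟧ ℚ.* ½ in
  ⟦ (2 * b + δ) * (2 * b) + 2 * δ ⟧ ≡ ⟦ 4 ⟧ ℚ.* (a ℚ.* ⟦ b ⟧ ℚ.+ a ℚ.- ⟦ b ⟧)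
⟦[2b+δ]2b+2δ⟧≡4[ab+a-b] b δ = begin
  ⟦ (2 * b + δ) * (2 * b) + 2 * δ ⟧
    ≡⟨ ⟦⟧-homo-+ ((2 * b + δ) * (2 * b)) (2 * δ) ⟩
  ⟦ (2 * b + δ) * (2 * b) ⟧ ℚ.+ ⟦ 2 * δ ⟧
    ≡⟨ cong₂ ℚ._+_ (⟦⟧-homo-* (2 * b + δ) (2 * b)) (⟦⟧-homo-* 2 δ) ⟩
  ⟦ 2 * b + δ ⟧ ℚ.* ⟦ 2 * b ⟧ ℚ.+ ⟦ 2 ⟧ ℚ.* ⟦ δ ⟧
    ≡⟨ cong (λ t → t ℚ.* ⟦ 2 * b ⟧ ℚ.+ ⟦ 2 ⟧ ℚ.* ⟦ δ ⟧) (⟦⟧-homo-+ (2 * b) δ) ⟩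
  (⟦ 2 * b ⟧ ℚ.+ ⟦ δ ⟧) ℚ.* ⟦ 2 * b ⟧ ℚ.+ ⟦ 2 ⟧ ℚ.* ⟦ δ ⟧
    ≡⟨ cong (λ t → (t ℚ.+ ⟦ δ ⟧) ℚ.* t ℚ.+ ⟦ 2 ⟧ ℚ.* ⟦ δ ⟧) (⟦⟧-homo-* 2 b) ⟩
  (⟦ 2 ⟧ ℚ.* ⟦ b ⟧ ℚ.+ ⟦ δ ⟧) ℚ.* (⟦ 2 ⟧ ℚ.* ⟦ b ⟧) ℚ.+ ⟦ 2 ⟧ ℚ.* ⟦ δ ⟧
    ≡⟨ identity ⟦ b ⟧ ⟦ δ ⟧ ⟩
  ⟦ 4 ⟧ ℚ.* ((⟦ b ⟧ ℚ.+ ⟦ δ ⟧ ℚ.* ½) ℚ.* ⟦ b ⟧ ℚ.+ (⟦ b ⟧ ℚ.+ ⟦ δ ⟧ ℚ.* ½) ℚ.- ⟦ b ⟧)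
    ∎
  where
  open ≡-Reasoning
  identity : ∀ x y → (⟦ 2 ⟧ ℚ.* x ℚ.+ y) ℚ.* (⟦ 2 ⟧ ℚ.* x) ℚ.+ ⟦ 2 ⟧ ℚ.* y
                   ≡ ⟦ 4 ⟧ ℚ.* ((x ℚ.+ y ℚ.* ½) ℚ.* x ℚ.+ (x ℚ.+ y ℚ.* ½) ℚ.- x)
  identity = solve 2 (λ x y → (con ⟦ 2 ⟧ :* x :+ y) :* (con ⟦ 2 ⟧ :* x) :+ con ⟦ 2 ⟧ :* y
                          := con ⟦ 4 ⟧ :* ((x :+ y :* con ½) :* x :+ (x :+ y :* con ½) :- x)) refl

⟦δ²⟧≡4[a-b]² : ∀ b δ → let a = ⟦ b ⟧ ℚ.+ ⟦ δ ⟧ ℚ.* ½ in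
  ⟦ δ * δ ⟧ ≡ ⟦ 4 ⟧ ℚ.* ((a ℚ.- ⟦ b ⟧) ℚ.* (a ℚ.- ⟦ b ⟧))
⟦δ²⟧≡4[a-b]² b δ = trans (⟦⟧-homo-* δ δ) (identity ⟦ b ⟧ ⟦ δ ⟧)
  where
  identity : ∀ x y → y ℚ.* y ≡ ⟦ 4 ⟧ ℚ.* ((x ℚ.+ y ℚ.* ½ ℚ.- x) ℚ.* (x ℚ.+ y ℚ.* ½ ℚ.- x))
  identity = solve 2 (λ x y → y :* y := con ⟦ 4 ⟧ :* ((x :+ y :* con ½ :- x) :* (x :+ y :* con ½ :- x))) refl

ab+a-b<[a-b]²L/b′ : ∀ {b δ P} L .{{_ : NonZero b}} →
  (2 * b + δ) * (2 * b) + 2 * δ < δ * δ * P → ⟦ b * P ⟧ ℚ.≤ L →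
  let a = ⟦ b ⟧ ℚ.+ ⟦ δ ⟧ ℚ.* ½
  in a ℚ.* ⟦ b ⟧ ℚ.+ a ℚ.- ⟦ b ⟧ ℚ.< ((a ℚ.- ⟦ b ⟧) ℚ.* (a ℚ.- ⟦ b ⟧)) ℚ.* (L ÷ℕ b)
ab+a-b<[a-b]²L/b′ {b} {δ} {P} L doubled bP≤L = ℚ.*-cancelˡ-<-nonNeg ⟦ 4 ⟧ (begin-strict
  ⟦ 4 ⟧ ℚ.* (a ℚ.* ⟦ b ⟧ ℚ.+ a ℚ.- ⟦ b ⟧)     ≡⟨ ⟦[2b+δ]2b+2δ⟧≡4[ab+a-b] b δ ⟨
  ⟦ (2 * b + δ) * (2 * b) + 2 * δ ⟧          <⟨ ⟦⟧-mono-< doubled ⟩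
  ⟦ δ * δ * P ⟧                              ≡⟨ ⟦⟧-homo-* (δ * δ) P ⟩
  ⟦ δ * δ ⟧ ℚ.* ⟦ P ⟧                        ≤⟨ ℚ.*-monoˡ-≤-nonNeg ⟦ δ * δ ⟧ {{δ²≥0}} (*≤⇒≤÷ℕ L bP≤L) ⟩
  ⟦ δ * δ ⟧ ℚ.* (L ÷ℕ b)                     ≡⟨ cong (ℚ._* (L ÷ℕ b)) (⟦δ²⟧≡4[a-b]² b δ) ⟩
  ⟦ 4 ⟧ ℚ.* [a-b]² ℚ.* (L ÷ℕ b)              ≡⟨ ℚ.*-assoc ⟦ 4 ⟧ [a-b]² (L ÷ℕ b) ⟩
  ⟦ 4 ⟧ ℚ.* ([a-b]² ℚ.* (L ÷ℕ b))            ∎)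
  where
  open ℚ.≤-Reasoning
  a : ℚ
  a = ⟦ b ⟧ ℚ.+ ⟦ δ ⟧ ℚ.* ½
  [a-b]² : ℚ
  [a-b]² = (a ℚ.- ⟦ b ⟧) ℚ.* (a ℚ.- ⟦ b ⟧)
  δ²≥0 : ℚ.NonNegative ⟦ δ * δ ⟧
  δ²≥0 = ℚ.normalize-nonNeg (δ * δ) 1

ab+a-b<[a-b]²L/b : ∀ {A b p r} L .{{_ : NonZero b}} → 1 ≤ p → 1 ≤ r →
  3 * (A * (p ∸ 1) * (r ∸ 1)) ≡ 2 * (b * p * r + 1) → ⟦ b * p * r ⟧ ℚ.≤ L →
  let a = (+ 3 / 2) ℚ.* ⟦ A ⟧
  in a ℚ.* ⟦ b ⟧ ℚ.+ a ℚ.- ⟦ b ⟧ ℚ.< ((a ℚ.- ⟦ b ⟧) ℚ.* (a ℚ.- ⟦ b ⟧)) ℚ.* (L ÷ℕ b)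
ab+a-b<[a-b]²L/b {A} {b} {p} {r} L 1≤p 1≤r totient bpr≤L =
  subst (λ a → a ℚ.* ⟦ b ⟧ ℚ.+ a ℚ.- ⟦ b ⟧ ℚ.< ((a ℚ.- ⟦ b ⟧) ℚ.* (a ℚ.- ⟦ b ⟧)) ℚ.* (L ÷ℕ b))
    (sym (3A/2≡b+δ/2 {A} {b} {δ} (sym 2b+δ≡3A)))
    (ab+a-b<[a-b]²L/b′ {b} {δ} {p * r} L
      (totient-relation⇒inequality {{m*n≢0 2 b}} 1≤p 1≤r relation′) b[pr]≤L)
  where
  relation : 3 * A * (p ∸ 1) * (r ∸ 1) ≡ 2 * b * (p * r) + 2
  relation = trans (reassociate A (p ∸ 1) (r ∸ 1)) (trans totient (expand b p r))
    where
    reassociate : ∀ A x y → 3 * A * x * y ≡ 3 * (A * x * y)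
    reassociate = solve-∀
    expand : ∀ b p r → 2 * (b * p * r + 1) ≡ 2 * b * (p * r) + 2
    expand = solve-∀
  2b≤3A : 2 * b ≤ 3 * A
  2b≤3A = <⇒≤ (totient-relation⇒< {3 * A} {2 * b} {p} {r} relation)
  δ : ℕ
  δ = proj₁ (m≤n⇒∃[o]m+o≡n 2b≤3A)
  2b+δ≡3A : 2 * b + δ ≡ 3 * A
  2b+δ≡3A = proj₂ (m≤n⇒∃[o]m+o≡n 2b≤3A)
  relation′ : (2 * b + δ) * (p ∸ 1) * (r ∸ 1) ≡ 2 * b * (p * r) + 2
  relation′ = subst (λ α → α * (p ∸ 1) * (r ∸ 1) ≡ 2 * b * (p * r) + 2) (sym 2b+δ≡3A) relation
  b[pr]≤L : ⟦ b * (p * r) ⟧ ℚ.≤ L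
  b[pr]≤L = subst (λ m → ⟦ m ⟧ ℚ.≤ L) (*-assoc b p r) bpr≤L

lemma12 : (n k : ℕ) (q : ℕ → ℕ)
    → 1 ℕ.≤ n
    → ⟦ φ n ⟧ ≡ (+ 2 / 3) ℚ.* ⟦ n ℕ.+ 1 ⟧
    → 3 ℕ.≤ k
    → (∀ i → 1 ℕ.≤ i → i ℕ.≤ k → Prime (q i))
    → 5 ℕ.≤ q 1
    → (∀ i → 1 ℕ.≤ i → i ℕ.< k → q i ℕ.< q (suc i))
    → n ≡ ∏ q k
    → (L : ℚ) → ⟦ n ⟧ ℚ.≤ L
    → (∀ j → j ℕ.≤ k ∸ 1 → ⟦ q (suc j) ^ (k ∸ j) ⟧ ℚ.≤ L ÷ℕ ∏ q j)
      × (let b = ⟦ ∏ q (k ∸ 2) ⟧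
             a = (+ 3 / 2) ℚ.* ⟦ ∏ (λ i → q i ∸ 1) (k ∸ 2) ⟧
         in a ℚ.* b ℚ.+ a ℚ.- b ℚ.< ((a ℚ.- b) ℚ.* (a ℚ.- b)) ℚ.* (L ÷ℕ ∏ q (k ∸ 2)))
lemma12 _ zero          _ _ _ ()       _ _ _ _ _ _
lemma12 _ (suc zero)    _ _ _ (s≤s ()) _ _ _ _ _ _
lemma12 _ k@(suc (suc k₂)) q _ φ≡⅔[n+1] _ q-prime _ increasing refl L n≤L =
  part-i , ab+a-b<[a-b]²L/b {∏ (λ i → q i ∸ 1) k₂} {∏ q k₂} L {{∏-nonZero k₂ (m≤n+m k₂ 2)}}
             (q-positive (suc k₂) z<s (n≤1+n _)) (q-positive k z<s ≤-refl) totient n≤L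
  where
  open IncreasingPrimes k q q-prime increasing
  part-i : ∀ j → j ≤ k ∸ 1 → ⟦ q (suc j) ^ (k ∸ j) ⟧ ℚ.≤ L ÷ℕ ∏ q j
  part-i j j≤k∸1 = q[1+j]^[k∸j]≤L/∏ j (≤-trans j≤k∸1 (m∸n≤m k 1)) n≤L
  totient : 3 * ∏ (λ i → q i ∸ 1) k ≡ 2 * (∏ q k + 1)
  totient = trans (cong (3 *_) (sym (φ-∏ k ≤-refl))) (3φ≡2[n+1] {∏ q k} φ≡⅔[n+1])
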